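{- Let $d,k,m,n$ be positive integers with $1\leq d\leq\lfloor n/2\rfloor$ and $3\leq k\leq \lfloor n/2\rfloor+2$, and let $C_n$ be the cycle with vertex set $\{0,\ldots,n-1\}$ and edges $\{i,(i+1)\bmod n\}$. If $\mathrm{gp}^k_d(C_n)=m$, then the set \[J^0_{n,m}=\left\{\left\lfloor \tfrac{ni}{m}\right\rfloor : i\in\mathbb{Z},\ 0\leq i<m\right\}\] is a $k$-general $d$-position set in $C_n$.
   Context: For a graph $G$, a geodesic of $G$ is a shortest path between two vertices of $G$; its length $\lambda(g)$ is its number of edges and $V(g)$ is its vertex set. For integers $d\ge1$, $k\ge2$, a set $S\subseteq V(G)$ is a $k$-general $d$-position set in $G$ if for every geodesic $g$ of $G$, $|S\cap V(g)|\geq k$ implies $\lambda(g)>d$. The $k$-general $d$-position number $\mathrm{gp}^k_d(G)$ is the largest cardinality of a $k$-general $d$-position set in $G$. -}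

module Defs where

open import Data.Nat using (ℕ; zero; suc; _≤_; _<_; _*_; _∸_; _≡ᵇ_; NonZero)
open import Data.Nat.DivMod using (_/_)
open import Data.Fin using (Fin; toℕ)
open import Data.Fin.Subset using (Subset; _∈_; ∣_∣)
open import Data.Fin.Subset.Properties using (_∈?_)
open import Data.List using (List; []; _∷_; length; filter; head; last; upTo)
open import Data.Bool.ListAction using (any)
open import Data.List.Relation.Unary.Linked using (Linked)
open import Data.List.Relation.Unary.Unique.Propositional using (Unique)
open import Data.Vec using (tabulate)
open import Data.Product using (_×_; Σ)
open import Data.Sum using (_⊎_)
open import Relation.Binary.PropositionalEquality using (_≡_)

CycSucc : (n : ℕ) → Fin n → Fin n → Set
CycSucc n u v = (toℕ v ≡ suc (toℕ u)) ⊎ (suc (toℕ u) ≡ n × toℕ v ≡ 0)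

Adj : (n : ℕ) → Fin n → Fin n → Set
Adj n u v = CycSucc n u v ⊎ CycSucc n v u

IsPath : (n : ℕ) → List (Fin n) → Set
IsPath n p = (1 ≤ length p) × Linked (Adj n) p × Unique p

len : ∀ {n} → List (Fin n) → ℕ
len p = length p ∸ 1

IsGeodesic : (n : ℕ) → List (Fin n) → Set
IsGeodesic n g = IsPath n g ×
  ((p : List (Fin n)) → IsPath n p → head p ≡ head g → last p ≡ last g →
     len g ≤ len p)

-- |S ∩ V(g)| (vertices of a path are distinct)
countIn : ∀ {n} → Subset n → List (Fin n) → ℕ
countIn S g = length (filter (λ x → x ∈? S) g)

IsKGenDPos : (n k d : ℕ) → Subset n → Set
IsKGenDPos n k d S =
  (g : List (Fin n)) → IsGeodesic n g → k ≤ countIn S g → d < len g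

GpIs : (n k d m : ℕ) → Set
GpIs n k d m =
  Σ (Subset n) (λ S → IsKGenDPos n k d S × ∣ S ∣ ≡ m) ×
  ((T : Subset n) → IsKGenDPos n k d T → ∣ T ∣ ≤ m)

J0 : (n m : ℕ) → .{{NonZero m}} → Subset n
J0 n m = tabulate (λ x → any (λ i → (n * i) / m ≡ᵇ toℕ x) (upTo m))

-- Counting, over all n windows of d+1 consecutive vertices (each a geodesic since 2d ≤ n), how
-- often every vertex is covered shows that a k-general d-position set S of C_n satisfies
-- |S|(d+1) ≤ n(k-1); hence m(d+1) ≤ n(k-1). Conversely, a path of length ℓ ≤ d lies in an arc
-- {L, …, L+ℓ}. A vertex ⌊ni/m⌋ of J⁰ in that arc lifts to an index j with ⌊nj/m⌋ ∈ [L, L+ℓ],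
-- i.e. Lm ≤ nj < (L+ℓ+1)m, distinct vertices giving distinct j. These j lie in an interval of
-- length (ℓ+1)m/n ≤ k-1, so the path meets J⁰ in at most k-1 vertices.
module Submission where

open import Defs
open import Data.Bool using (true; false; if_then_else_)
open import Data.Bool.ListAction using (any)
open import Data.Bool.Properties using (T-≡)
open import Data.Fin using (Fin; toℕ; fromℕ; inject₁)
import Data.Fin as Fin
open import Data.Fin.Properties
  using (toℕ<n; toℕ-injective; toℕ-fromℕ<; fromℕ<-cong; toℕ-fromℕ; toℕ-inject₁)
open import Data.Fin.Subset using (Subset; ∣_∣) renaming (_∈_ to _∈ₛ_)
open import Data.Fin.Subset.Properties using (_∈?_)
open import Data.List
  using (List; []; _∷_; _++_; length; map; filter; applyUpTo; upTo; head; last)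
open import Data.List.Extrema.Nat using (min; min≤⊤; min≤xs; argmin-all)
open import Data.List.Membership.Propositional using (_∈_)
open import Data.List.Membership.Propositional.Properties
  using (∈-∃++; ∈-++⁺ˡ; ∈-++⁺ʳ; ∈-++⁻; ∈-applyUpTo⁺; ∈-applyUpTo⁻; ∈-filter⁻)
open import Data.List.Properties using (length-++; length-map; length-applyUpTo)
open import Data.List.Relation.Binary.Subset.Propositional using (_⊆_)
open import Data.List.Relation.Unary.All as All using (All; []; _∷_)
open import Data.List.Relation.Unary.Any using (here; there; satisfied)
open import Data.List.Relation.Unary.Any.Properties using (any⁻)
open import Data.List.Relation.Unary.Linked using (Linked; _∷_)
import Data.List.Relation.Unary.Linked.Properties as Linked
open import Data.List.Relation.Unary.Unique.Propositional using (Unique; _∷_)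
import Data.List.Relation.Unary.Unique.Propositional.Properties as Unique
import Data.List.Relation.Unary.Unique.Setoid.Properties as UniqueSetoid
open import Data.Maybe using (just)
open import Data.Maybe.Properties using (just-injective)
open import Data.Nat
open import Data.Nat.DivMod
open import Data.Nat.Divisibility using (divides-refl)
open import Data.Nat.Properties
open import Algebra.Properties.CommutativeMonoid.Sum +-0-commutativeMonoid
  using (sum; sum-syntax; sum-cong-≗; sum-init-last; ∑-comm)
open import Data.Product using (∃-syntax; _×_; _,_; proj₂)
import Data.Product as Product
open import Data.Sum using (inj₁; inj₂)
open import Data.Vec using ([]; _∷_)
open import Data.Vec.Properties using (lookup∘tabulate; []=⇒lookup)
open import Function using (_∘_; _⇔_; mk⇔; Equivalence)
open import Level using (Level)
open import Relation.Binary.PropositionalEquality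
open import Relation.Nullary using (does; yes; no; contradiction)
open import Relation.Unary using (Pred)

private
  variable
    a p : Level
    A : Set a

Unique-⊆⇒length≤ : {xs ys : List A} → Unique xs → xs ⊆ ys → length xs ≤ length ys
Unique-⊆⇒length≤ {xs = []} _ _ = z≤n
Unique-⊆⇒length≤ {xs = x ∷ xs} (x∉xs ∷ uniq) x∷xs⊆ys with ∈-∃++ (x∷xs⊆ys (here refl))
... | as , bs , refl = begin
  suc (length xs)               ≤⟨ s≤s (Unique-⊆⇒length≤ uniq xs⊆as++bs) ⟩
  suc (length (as ++ bs))       ≡⟨ cong suc (length-++ as) ⟩
  suc (length as + length bs)   ≡⟨ +-suc (length as) (length bs) ⟨
  length as + length (x ∷ bs)   ≡⟨ length-++ as ⟨
  length (as ++ x ∷ bs)         ∎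
  where
  open ≤-Reasoning
  xs⊆as++bs : xs ⊆ as ++ bs
  xs⊆as++bs y∈xs with ∈-++⁻ as (x∷xs⊆ys (there y∈xs))
  ... | inj₁ y∈as         = ∈-++⁺ˡ y∈as
  ... | inj₂ (here refl)  = contradiction refl (All.lookup x∉xs y∈xs)
  ... | inj₂ (there y∈bs) = ∈-++⁺ʳ as y∈bs

-- The elements all lie in the window [lo, lo + B) above the minimum lo.
Unique-spread⇒length≤ : ∀ {P : Pred ℕ p} {B} {js : List ℕ} → Unique js → All P js →
  (∀ {a b} → P a → P b → b < a + B) → length js ≤ B
Unique-spread⇒length≤ {js = []} _ _ _ = z≤n
Unique-spread⇒length≤ {B = B} {js = j ∷ js} uniq (pj ∷ pjs) spread =
  subst (length (j ∷ js) ≤_) (length-applyUpTo (lo +_) B) (Unique-⊆⇒length≤ uniq ⊆window)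
  where
  lo = min j js
  lo≤ : All (lo ≤_) (j ∷ js)
  lo≤ = min≤⊤ j js ∷ min≤xs j js
  ⊆window : j ∷ js ⊆ applyUpTo (lo +_) B
  ⊆window {b} b∈ =
    subst (_∈ applyUpTo (lo +_) B) (m+[n∸m]≡n lo≤b) (∈-applyUpTo⁺ (lo +_) b∸lo<B)
    where
    lo≤b = All.lookup lo≤ b∈
    b∸lo<B : b ∸ lo < B
    b∸lo<B = subst (b ∸ lo <_) (m+n∸m≡n lo B)
      (∸-monoˡ-< (spread (argmin-all (λ x → x) pj pjs) (All.lookup (pj ∷ pjs) b∈)) lo≤b)

preimages : (r : ℕ → A) {P : Pred ℕ p} {xs : List A} →
  All (λ x → ∃[ j ] r j ≡ x × P j) xs → ∃[ js ] map r js ≡ xs × All P js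
preimages r [] = [] , refl , []
preimages r ((j , refl , pj) ∷ lifts) with preimages r lifts
... | js , refl , pjs = j ∷ js , refl , pj ∷ pjs

Unique-preimages⇒length≤ : (r : ℕ → A) {P : Pred ℕ p} {B : ℕ} {xs : List A} → Unique xs →
  All (λ x → ∃[ j ] r j ≡ x × P j) xs → (∀ {a b} → P a → P b → b < a + B) →
  length xs ≤ B
Unique-preimages⇒length≤ r uniq lifts spread with preimages r lifts
... | js , refl , pjs = subst (_≤ _) (sym (length-map r js))
  (Unique-spread⇒length≤ (UniqueSetoid.map⁻ (setoid _) (setoid _) (cong r) uniq) pjs spread)

last⇒∈ : ∀ {xs : List A} {y} → last xs ≡ just y → y ∈ xs
last⇒∈ {xs = _ ∷ []}    refl = here refl
last⇒∈ {xs = _ ∷ _ ∷ _} eq   = there (last⇒∈ eq)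

last-applyUpTo : ∀ (f : ℕ → A) n → last (applyUpTo f (suc n)) ≡ just (f n)
last-applyUpTo f zero    = refl
last-applyUpTo f (suc n) = last-applyUpTo (f ∘ suc) n

∑-const : ∀ n c → ∑[ i < n ] c ≡ n * c
∑-const zero    c = refl
∑-const (suc n) c = cong (c +_) (∑-const n c)

∑-mono-≤ : ∀ {n} {f g : Fin n → ℕ} → (∀ i → f i ≤ g i) → sum f ≤ sum g
∑-mono-≤ {zero}  _   = z≤n
∑-mono-≤ {suc n} f≤g = +-mono-≤ (f≤g Fin.zero) (∑-mono-≤ (f≤g ∘ Fin.suc))

∑-rotate : ∀ n (h : ℕ → ℕ) → h n ≡ h 0 →
  ∑[ i < n ] h (suc (toℕ i)) ≡ ∑[ i < n ] h (toℕ i)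
∑-rotate zero    h _       = refl
∑-rotate (suc n) h hn≡h0 = begin
  ∑[ i < suc n ] h (suc (toℕ i))
    ≡⟨ sum-init-last (h ∘ suc ∘ toℕ) ⟩
  ∑[ i < n ] h (suc (toℕ (inject₁ i))) + h (suc (toℕ (fromℕ n)))
    ≡⟨ cong₂ _+_ (sum-cong-≗ {n} (cong (h ∘ suc) ∘ toℕ-inject₁))
                 (trans (cong (h ∘ suc) (toℕ-fromℕ n)) hn≡h0) ⟩
  ∑[ i < n ] h (suc (toℕ i)) + h 0
    ≡⟨ +-comm _ (h 0) ⟩
  ∑[ i < suc n ] h (toℕ i)
    ∎
  where open ≡-Reasoning

∑-shift : ∀ n (h : ℕ → ℕ) → (∀ a → h (n + a) ≡ h a) →
  ∀ t → ∑[ i < n ] h (toℕ i + t) ≡ ∑[ i < n ] h (toℕ i)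
∑-shift n h periodic zero    = sum-cong-≗ {n} (cong h ∘ +-identityʳ ∘ toℕ)
∑-shift n h periodic (suc t) = begin
  ∑[ i < n ] h (toℕ i + suc t)    ≡⟨ sum-cong-≗ {n} (λ i → cong h (+-suc (toℕ i) t)) ⟩
  ∑[ i < n ] h (suc (toℕ i) + t)  ≡⟨ ∑-rotate n (λ c → h (c + t)) (periodic t) ⟩
  ∑[ i < n ] h (toℕ i + t)        ≡⟨ ∑-shift n h periodic t ⟩
  ∑[ i < n ] h (toℕ i)            ∎
  where open ≡-Reasoning

indicator : ∀ {n} → Subset n → Fin n → ℕ
indicator S x = if does (x ∈? S) then 1 else 0

∑-indicator : ∀ {n} (S : Subset n) → ∑[ i < n ] indicator S i ≡ ∣ S ∣
∑-indicator []          = refl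
∑-indicator (true ∷ S)  = cong suc (∑-indicator S)
∑-indicator (false ∷ S) = ∑-indicator S

countIn-∷ : ∀ {n} (S : Subset n) x xs → countIn S (x ∷ xs) ≡ indicator S x + countIn S xs
countIn-∷ S x xs with does (x ∈? S)
... | true  = refl
... | false = refl

countIn-applyUpTo : ∀ {n} (S : Subset n) (f : ℕ → Fin n) k →
  countIn S (applyUpTo f k) ≡ ∑[ t < k ] indicator S (f (toℕ t))
countIn-applyUpTo S f zero    = refl
countIn-applyUpTo S f (suc k) =
  trans (countIn-∷ S (f 0) _) (cong (indicator S (f 0) +_) (countIn-applyUpTo S (f ∘ suc) k))

m<[1+m/n]*n : ∀ m n .{{_ : NonZero n}} → m < suc (m / n) * n
m<[1+m/n]*n m n = begin-strict
  m                  ≡⟨ m≡m%n+[m/n]*n m n ⟩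
  m % n + m / n * n  <⟨ +-monoˡ-< (m / n * n) (m%n<n m n) ⟩
  n + m / n * n      ∎
  where open ≤-Reasoning

L≤m/n≤L+ℓ⇒L*n≤m<[L+1+ℓ]*n : ∀ m n .{{_ : NonZero n}} {L ℓ} → L ≤ m / n → m / n ≤ L + ℓ →
  L * n ≤ m × m < (L + suc ℓ) * n
L≤m/n≤L+ℓ⇒L*n≤m<[L+1+ℓ]*n m n {L} {ℓ} L≤m/n m/n≤L+ℓ =
  ≤-trans (*-monoˡ-≤ n L≤m/n) (m/n*n≤m m n) ,
  <-≤-trans (m<[1+m/n]*n m n)
    (*-monoˡ-≤ n (subst (suc (m / n) ≤_) (sym (+-suc L ℓ)) (s≤s m/n≤L+ℓ)))

[n*[i+m*q]]/m≡n*i/m+n*q : ∀ n m .{{_ : NonZero m}} i q →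
  n * (i + m * q) / m ≡ n * i / m + n * q
[n*[i+m*q]]/m≡n*i/m+n*q n m i q = begin
  n * (i + m * q) / m        ≡⟨ /-congˡ (trans (*-distribˡ-+ n i (m * q))
                                               (cong (n * i +_) nmq≡nqm)) ⟩
  (n * i + n * q * m) / m    ≡⟨ +-distrib-/-∣ʳ (n * i) (divides-refl (n * q)) ⟩
  n * i / m + n * q * m / m  ≡⟨ cong (n * i / m +_) (m*n/n≡m (n * q) m) ⟩
  n * i / m + n * q          ∎
  where
  open ≡-Reasoning
  nmq≡nqm : n * (m * q) ≡ n * q * m
  nmq≡nqm = trans (cong (n *_) (*-comm m q)) (sym (*-assoc n q m))

m≤n/2⇒m+m≤n : ∀ {m n} → m ≤ n / 2 → m + m ≤ n
m≤n/2⇒m+m≤n {m} {n} m≤n/2 = begin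
  m + m      ≡⟨ cong (m +_) (+-identityʳ m) ⟨
  2 * m      ≡⟨ *-comm 2 m ⟩
  m * 2      ≤⟨ *-monoˡ-≤ 2 m≤n/2 ⟩
  n / 2 * 2  ≤⟨ m/n*n≤m n 2 ⟩
  n          ∎
  where open ≤-Reasoning

m+m≤n⇒m<n : ∀ {m n} .{{_ : NonZero n}} → m + m ≤ n → m < n
m+m≤n⇒m<n {zero}  {n} _    = >-nonZero⁻¹ n
m+m≤n⇒m<n {suc m}     2m≤n = <-≤-trans (m<m+n (suc m) z<s) 2m≤n

module _ (N : ℕ) .{{_ : NonZero N}} where

  toℕ-mod : (x : Fin N) → toℕ x mod N ≡ x
  toℕ-mod x = toℕ-injective (trans (toℕ-fromℕ< _) (m<n⇒m%n≡m (toℕ<n x)))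

  %-≡⇒mod-≡ : ∀ {a b} → a % N ≡ b % N → a mod N ≡ b mod N
  %-≡⇒mod-≡ e = fromℕ<-cong _ _ e _ _

  mod-≡⇒%-≡ : ∀ {a b} → a mod N ≡ b mod N → a % N ≡ b % N
  mod-≡⇒%-≡ e = trans (sym (toℕ-fromℕ< _)) (trans (cong toℕ e) (toℕ-fromℕ< _))

  [m%n+o]%n≡[m+o]%n : ∀ a c → (a % N + c) % N ≡ (a + c) % N
  [m%n+o]%n≡[m+o]%n a c = begin
    (a % N + c) % N          ≡⟨ %-distribˡ-+ (a % N) c N ⟩
    (a % N % N + c % N) % N  ≡⟨ cong (λ r → (r + c % N) % N) (m%n%n≡m%n a N) ⟩
    (a % N + c % N) % N      ≡⟨ %-distribˡ-+ a c N ⟨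
    (a + c) % N              ∎
    where open ≡-Reasoning

  mod-+ : ∀ a c → (toℕ (a mod N) + c) mod N ≡ (a + c) mod N
  mod-+ a c = %-≡⇒mod-≡
    (trans (cong (λ r → (r + c) % N) (toℕ-fromℕ< _)) ([m%n+o]%n≡[m+o]%n a c))

  +-mod-congˡ : ∀ {a b} c → a mod N ≡ b mod N → (a + c) mod N ≡ (b + c) mod N
  +-mod-congˡ {a} {b} c e =
    trans (sym (mod-+ a c)) (trans (cong (λ x → (toℕ x + c) mod N) e) (mod-+ b c))

  +N-mod : ∀ a → (a + N) mod N ≡ a mod N
  +N-mod a = %-≡⇒mod-≡ ([m+n]%n≡m%n a N)

  suc-mod : ∀ a → suc (toℕ (a mod N)) mod N ≡ suc a mod N
  suc-mod a =
    trans (cong (_mod N) (+-comm 1 _)) (trans (mod-+ a 1) (cong (_mod N) (+-comm a 1)))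

  mod-no-wrap : ∀ c s → (c + s) mod N ≡ c mod N → s < N → s ≡ 0
  mod-no-wrap c s e s<N = trans s≡qN (cong (_* N) q≡0)
    where
    r = c % N
    q = (r + s) / N
    s≡qN : s ≡ q * N
    s≡qN = +-cancelˡ-≡ r s (q * N) (begin
      r + s                ≡⟨ m≡m%n+[m/n]*n (r + s) N ⟩
      (r + s) % N + q * N  ≡⟨ cong (_+ q * N) (trans ([m%n+o]%n≡[m+o]%n c s) (mod-≡⇒%-≡ e)) ⟩
      r + q * N            ∎)
      where open ≡-Reasoning
    q≡0 : q ≡ 0
    q≡0 = n<1⇒n≡0 (*-cancelʳ-< N q 1 (subst₂ _<_ s≡qN (sym (*-identityˡ N)) s<N))

  mod-≤-injective : ∀ b {x y} → x ≤ y → (b + x) mod N ≡ (b + y) mod N → y < N → x ≡ y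
  mod-≤-injective b {x} {y} x≤y e y<N = ≤-antisym x≤y (m∸n≡0⇒m≤n y∸x≡0)
    where
    b+x+[y∸x]≡b+y : b + x + (y ∸ x) ≡ b + y
    b+x+[y∸x]≡b+y = trans (+-assoc b x (y ∸ x)) (cong (b +_) (m+[n∸m]≡n x≤y))
    y∸x≡0 : y ∸ x ≡ 0
    y∸x≡0 = mod-no-wrap (b + x) (y ∸ x) (trans (cong (_mod N) b+x+[y∸x]≡b+y) (sym e))
      (≤-<-trans (m∸n≤m y x) y<N)

  mod-injective : ∀ b {x y} → (b + x) mod N ≡ (b + y) mod N → x < N → y < N → x ≡ y
  mod-injective b {x} {y} e x<N y<N with ≤-total x y
  ... | inj₁ x≤y = mod-≤-injective b x≤y e y<N
  ... | inj₂ y≤x = sym (mod-≤-injective b y≤x (sym e) x<N)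

  CycSucc⇔ : ∀ {u v} → CycSucc N u v ⇔ v ≡ suc (toℕ u) mod N
  CycSucc⇔ {u} {v} = mk⇔ to from
    where
    to : CycSucc N u v → v ≡ suc (toℕ u) mod N
    to (inj₁ v≡1+u)         = trans (sym (toℕ-mod v)) (cong (_mod N) v≡1+u)
    to (inj₂ (1+u≡N , v≡0)) = toℕ-injective (trans v≡0 (sym (begin
      toℕ (suc (toℕ u) mod N)  ≡⟨ toℕ-fromℕ< _ ⟩
      suc (toℕ u) % N          ≡⟨ cong (_% N) 1+u≡N ⟩
      N % N                    ≡⟨ n%n≡0 N ⟩
      0                        ∎)))
      where open ≡-Reasoning
    from : v ≡ suc (toℕ u) mod N → CycSucc N u v
    from refl with m≤n⇒m<n∨m≡n (toℕ<n u)
    ... | inj₁ 1+u<N = inj₁ (trans (toℕ-fromℕ< _) (m<n⇒m%n≡m 1+u<N))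
    ... | inj₂ 1+u≡N =
      inj₂ (1+u≡N , trans (toℕ-fromℕ< _) (trans (cong (_% N) 1+u≡N) (n%n≡0 N)))

  CycSucc⇒pred : ∀ {u v} → CycSucc N u v → u ≡ (toℕ v + pred N) mod N
  CycSucc⇒pred {u} {v} u→v = sym (begin
    (toℕ v + pred N) mod N
      ≡⟨ +-mod-congˡ (pred N) (trans (toℕ-mod v) (Equivalence.to CycSucc⇔ u→v)) ⟩
    (suc (toℕ u) + pred N) mod N
      ≡⟨ cong (_mod N) (trans (sym (+-suc (toℕ u) (pred N))) (cong (toℕ u +_) (suc-pred N))) ⟩
    (toℕ u + N) mod N
      ≡⟨ +N-mod (toℕ u) ⟩
    toℕ u mod N
      ≡⟨ toℕ-mod u ⟩
    u ∎)
    where open ≡-Reasoning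

  -- a is not reduced mod N, so an arc may wrap around.
  arc : ℕ → ℕ → List (Fin N)
  arc a ℓ = applyUpTo (λ t → (a + t) mod N) (suc ℓ)

  arc-∈⁻ : ∀ {a ℓ x} → x ∈ arc a ℓ → ∃[ t ] t ≤ ℓ × x ≡ (a + t) mod N
  arc-∈⁻ {a} x∈ with ∈-applyUpTo⁻ (λ t → (a + t) mod N) x∈
  ... | t , t<1+ℓ , x≡ = t , s≤s⁻¹ t<1+ℓ , x≡

  arc-∈⁺ : ∀ {a ℓ t} → t ≤ ℓ → (a + t) mod N ∈ arc a ℓ
  arc-∈⁺ {a} t≤ℓ = ∈-applyUpTo⁺ (λ t → (a + t) mod N) (s≤s t≤ℓ)

  arc⊆arc-extendʳ : ∀ {a ℓ} → arc a ℓ ⊆ arc a (suc ℓ)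
  arc⊆arc-extendʳ x∈ with arc-∈⁻ x∈
  ... | t , t≤ℓ , refl = arc-∈⁺ (m≤n⇒m≤1+n t≤ℓ)

  -- a + pred N plays the role of a - 1, avoiding truncated subtraction.
  arc⊆arc-extendˡ : ∀ {a ℓ} → arc a ℓ ⊆ arc (a + pred N) (suc ℓ)
  arc⊆arc-extendˡ {a} {ℓ} x∈ with arc-∈⁻ x∈
  ... | t , t≤ℓ , refl = subst (_∈ arc (a + pred N) (suc ℓ)) shift (arc-∈⁺ (s≤s t≤ℓ))
    where
    shift : (a + pred N + suc t) mod N ≡ (a + t) mod N
    shift = trans (cong (_mod N) (begin
      a + pred N + suc t      ≡⟨ +-assoc a (pred N) (suc t) ⟩
      a + (pred N + suc t)    ≡⟨ cong (a +_) (+-suc (pred N) t) ⟩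
      a + (suc (pred N) + t)  ≡⟨ cong (λ n → a + (n + t)) (suc-pred N) ⟩
      a + (N + t)             ≡⟨ cong (a +_) (+-comm N t) ⟩
      a + (t + N)             ≡⟨ +-assoc a t N ⟨
      a + t + N               ∎)) (+N-mod (a + t))
      where open ≡-Reasoning

  len-arc : ∀ a ℓ → len (arc a ℓ) ≡ ℓ
  len-arc a ℓ = cong (_∸ 1) (length-applyUpTo (λ t → (a + t) mod N) (suc ℓ))

  arc-linked : ∀ a ℓ → Linked (Adj N) (arc a ℓ)
  arc-linked a ℓ = Linked.applyUpTo⁺₂ (λ t → (a + t) mod N) (suc ℓ) λ t →
    inj₁ (Equivalence.from CycSucc⇔ (trans (cong (_mod N) (+-suc a t)) (sym (suc-mod (a + t)))))

  arc-unique : ∀ a {ℓ} → ℓ < N → Unique (arc a ℓ)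
  arc-unique a ℓ<N = Unique.applyUpTo⁺₁ (λ t → (a + t) mod N) _ λ i<j j<1+ℓ e →
    let j<N = <-≤-trans j<1+ℓ ℓ<N in <⇒≢ i<j (mod-injective a e (<-trans i<j j<N) j<N)

  path⊆arc : ∀ {x g} → Linked (Adj N) (x ∷ g) → ∃[ L ] x ∷ g ⊆ arc L (length g)
  path⊆arc {x} {[]} _ = toℕ x , λ { (here refl) → here x≡x+0 }
    where
    x≡x+0 : x ≡ (toℕ x + 0) mod N
    x≡x+0 = sym (trans (cong (_mod N) (+-identityʳ (toℕ x))) (toℕ-mod x))
  path⊆arc {x} {y ∷ g} (x~y ∷ linked) with path⊆arc linked
  ... | L , y∷g⊆arc with arc-∈⁻ (y∷g⊆arc (here refl)) | x~y
  ... | t , t≤ℓ , refl | inj₁ x→y = L + pred N , λ where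
      (here refl) → subst (_∈ arc (L + pred N) (suc (length g))) (sym x≡)
                          (arc-∈⁺ (m≤n⇒m≤1+n t≤ℓ))
      (there z∈)  → arc⊆arc-extendˡ (y∷g⊆arc z∈)
    where
    x≡ : x ≡ (L + pred N + t) mod N
    x≡ = trans (CycSucc⇒pred x→y) (trans (mod-+ (L + t) (pred N)) (cong (_mod N)
      (trans (+-assoc L t (pred N))
        (trans (cong (L +_) (+-comm t (pred N))) (sym (+-assoc L (pred N) t))))))
  ... | t , t≤ℓ , refl | inj₂ y→x = L , λ where
      (here refl) → subst (_∈ arc L (suc (length g))) (sym x≡) (arc-∈⁺ (s≤s t≤ℓ))
      (there z∈)  → arc⊆arc-extendʳ (y∷g⊆arc z∈)
    where
    x≡ : x ≡ (L + suc t) mod N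
    x≡ = trans (Equivalence.to CycSucc⇔ y→x)
      (trans (suc-mod (L + t)) (cong (_mod N) (sym (+-suc L t))))

  -- If ℓ < d, the positions t₁ of u and t₂ of u + d in the arc are below N, forcing t₂ = t₁ + d.
  arc-spans-distance : ∀ {L ℓ d u} → d + d ≤ N →
    u ∈ arc L ℓ → (toℕ u + d) mod N ∈ arc L ℓ → d ≤ ℓ
  arc-spans-distance {L} {ℓ} {d} 2d≤N u∈ v∈ with d ≤? ℓ | arc-∈⁻ u∈ | arc-∈⁻ v∈
  ... | yes d≤ℓ | _ | _ = d≤ℓ
  ... | no d≰ℓ | t₁ , t₁≤ℓ , refl | t₂ , t₂≤ℓ , v≡ =
    ≤-trans (m≤n+m d t₁) (subst (_≤ ℓ) (sym t₁+d≡t₂) t₂≤ℓ)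
    where
    ℓ<d = ≰⇒> d≰ℓ
    t₁+d≡t₂ : t₁ + d ≡ t₂
    t₁+d≡t₂ = mod-injective L
      (trans (cong (_mod N) (sym (+-assoc L t₁ d))) (trans (sym (mod-+ (L + t₁) d)) v≡))
      (<-≤-trans (+-monoˡ-< d (≤-<-trans t₁≤ℓ ℓ<d)) 2d≤N)
      (<-≤-trans (≤-<-trans t₂≤ℓ ℓ<d) (≤-trans (m≤m+n d d) 2d≤N))

  arc-isGeodesic : ∀ a {d} → d + d ≤ N → IsGeodesic N (arc a d)
  arc-isGeodesic a {d} 2d≤N =
    (s≤s z≤n , arc-linked a d , arc-unique a (m+m≤n⇒m<n 2d≤N)) , shortest
    where
    shortest : (p : List (Fin N)) → IsPath N p → head p ≡ head (arc a d) →
      last p ≡ last (arc a d) → len (arc a d) ≤ len p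
    shortest (x ∷ g) (_ , linked , _) head≡ last≡ = subst (_≤ length g) (sym (len-arc a d))
      (arc-spans-distance 2d≤N (x∷g⊆arc (here refl)) (x∷g⊆arc far∈))
      where
      x∷g⊆arc = proj₂ (path⊆arc linked)
      x≡ : x ≡ (a + 0) mod N
      x≡ = just-injective head≡
      x+d≡a+d : (toℕ x + d) mod N ≡ (a + d) mod N
      x+d≡a+d = trans (cong (λ z → (toℕ z + d) mod N) x≡)
        (trans (mod-+ (a + 0) d) (cong (λ c → (c + d) mod N) (+-identityʳ a)))
      far∈ : (toℕ x + d) mod N ∈ x ∷ g
      far∈ = subst (_∈ x ∷ g) (sym x+d≡a+d)
        (last⇒∈ (trans last≡ (last-applyUpTo (λ t → (a + t) mod N) d)))

  arc-countIn≤ : ∀ {k d S} a → d + d ≤ N → IsKGenDPos N (suc k) d S → countIn S (arc a d) ≤ k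
  arc-countIn≤ {k} {d} {S} a 2d≤N S-gp with k <? countIn S (arc a d)
  ... | yes k<count = contradiction (S-gp _ (arc-isGeodesic a 2d≤N) k<count)
                                    (<-irrefl (sym (len-arc a d)))
  ... | no  k≮count = ≮⇒≥ k≮count

  ∑-countIn-arc : ∀ (S : Subset N) ℓ → ∑[ a < N ] countIn S (arc (toℕ a) ℓ) ≡ suc ℓ * ∣ S ∣
  ∑-countIn-arc S ℓ = begin
    ∑[ a < N ] countIn S (arc (toℕ a) ℓ)
      ≡⟨ sum-cong-≗ {N} (λ a → countIn-applyUpTo S (λ t → (toℕ a + t) mod N) (suc ℓ)) ⟩
    ∑[ a < N ] ∑[ t < suc ℓ ] χ (toℕ a + toℕ t)
      ≡⟨ ∑-comm {N} {suc ℓ} (λ a t → χ (toℕ a + toℕ t)) ⟩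
    ∑[ t < suc ℓ ] ∑[ a < N ] χ (toℕ a + toℕ t)
      ≡⟨ sum-cong-≗ {suc ℓ} (∑-shift N χ χ-periodic ∘ toℕ) ⟩
    ∑[ t < suc ℓ ] ∑[ a < N ] χ (toℕ a)
      ≡⟨ sum-cong-≗ {suc ℓ} (λ _ →
           trans (sum-cong-≗ {N} (cong (indicator S) ∘ toℕ-mod)) (∑-indicator S)) ⟩
    ∑[ t < suc ℓ ] ∣ S ∣
      ≡⟨ ∑-const (suc ℓ) ∣ S ∣ ⟩
    suc ℓ * ∣ S ∣
      ∎
    where
    open ≡-Reasoning
    χ : ℕ → ℕ
    χ c = indicator S (c mod N)
    χ-periodic : ∀ c → χ (N + c) ≡ χ c
    χ-periodic c = cong (indicator S) (trans (cong (_mod N) (+-comm N c)) (+N-mod c))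

  IsKGenDPos⇒∣S∣*[1+d]≤N*k : ∀ {k d S} → d + d ≤ N → IsKGenDPos N (suc k) d S →
    ∣ S ∣ * suc d ≤ N * k
  IsKGenDPos⇒∣S∣*[1+d]≤N*k {k} {d} {S} 2d≤N S-gp = begin
    ∣ S ∣ * suc d                         ≡⟨ *-comm ∣ S ∣ (suc d) ⟩
    suc d * ∣ S ∣                         ≡⟨ ∑-countIn-arc S d ⟨
    ∑[ a < N ] countIn S (arc (toℕ a) d)  ≤⟨ ∑-mono-≤ {N} (λ a → arc-countIn≤ (toℕ a) 2d≤N S-gp) ⟩
    ∑[ a < N ] k                          ≡⟨ ∑-const N k ⟩
    N * k                                 ∎
    where open ≤-Reasoning

  J0-∈⁻ : ∀ {m} .{{_ : NonZero m}} {x} → x ∈ₛ J0 N m → ∃[ i ] N * i / m ≡ toℕ x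
  J0-∈⁻ {m} {x} x∈J0 = Product.map₂ (≡ᵇ⇒≡ _ _) (satisfied (any⁻ _ (upTo m)
    (Equivalence.from T-≡ (trans (sym (lookup∘tabulate (λ y → any (λ i → N * i / m ≡ᵇ toℕ y)
                                                                    (upTo m)) x))
                                 ([]=⇒lookup x∈J0)))))

  J0-∈⇒lift : ∀ {m} .{{_ : NonZero m}} c → c mod N ∈ₛ J0 N m → ∃[ j ] N * j / m ≡ c
  J0-∈⇒lift {m} c c∈J0 with J0-∈⁻ c∈J0
  ... | i , ⌊Ni/m⌋≡c%N = i + m * q , (begin
    N * (i + m * q) / m  ≡⟨ [n*[i+m*q]]/m≡n*i/m+n*q N m i q ⟩
    N * i / m + N * q    ≡⟨ cong₂ _+_ (trans ⌊Ni/m⌋≡c%N (toℕ-fromℕ< _)) (*-comm N q) ⟩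
    c % N + q * N        ≡⟨ m≡m%n+[m/n]*n c N ⟨
    c                    ∎)
    where
    open ≡-Reasoning
    q = c / N

  J0-countIn≤ : ∀ {m k ℓ L} .{{_ : NonZero m}} {p : List (Fin N)} → m * suc ℓ ≤ N * k →
    Unique p → p ⊆ arc L ℓ → countIn (J0 N m) p ≤ k
  J0-countIn≤ {m} {k} {ℓ} {L} {p} mℓ≤Nk uniq p⊆arc =
    Unique-preimages⇒length≤ (λ j → (N * j / m) mod N)
      (Unique.filter⁺ (_∈? J0 N m) uniq) (All.tabulate preimage) spread
    where
    InWindow : ℕ → Set
    InWindow j = L * m ≤ N * j × N * j < (L + suc ℓ) * m
    preimage : ∀ {x} → x ∈ filter (_∈? J0 N m) p →
      ∃[ j ] (N * j / m) mod N ≡ x × InWindow j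
    preimage x∈ with ∈-filter⁻ (_∈? J0 N m) {xs = p} x∈
    ... | x∈p , x∈J0 with arc-∈⁻ (p⊆arc x∈p)
    ... | t , t≤ℓ , refl with J0-∈⇒lift (L + t) x∈J0
    ... | j , ⌊Nj/m⌋≡L+t = j , cong (_mod N) ⌊Nj/m⌋≡L+t ,
      L≤m/n≤L+ℓ⇒L*n≤m<[L+1+ℓ]*n (N * j) m
        (subst (L ≤_) (sym ⌊Nj/m⌋≡L+t) (m≤m+n L t))
        (subst (_≤ L + ℓ) (sym ⌊Nj/m⌋≡L+t) (+-monoʳ-≤ L t≤ℓ))
    spread : ∀ {a b} → InWindow a → InWindow b → b < a + k
    spread {a} {b} (Lm≤Na , _) (_ , Nb<[L+1+ℓ]m) = *-cancelˡ-< N b (a + k) (begin-strict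
      N * b              <⟨ Nb<[L+1+ℓ]m ⟩
      (L + suc ℓ) * m    ≡⟨ *-distribʳ-+ m L (suc ℓ) ⟩
      L * m + suc ℓ * m  ≤⟨ +-mono-≤ Lm≤Na (subst (_≤ N * k) (*-comm m (suc ℓ)) mℓ≤Nk) ⟩
      N * a + N * k      ≡⟨ *-distribˡ-+ N a k ⟨
      N * (a + k)        ∎)
      where open ≤-Reasoning

  J0-isKGenDPos : ∀ {m k d} .{{_ : NonZero m}} → m * suc d ≤ N * k →
    IsKGenDPos N (suc k) d (J0 N m)
  J0-isKGenDPos _ [] ((() , _) , _)
  J0-isKGenDPos {m} {k} {d} md≤Nk (x ∷ g) ((_ , linked , uniq) , _) k<count
    with d <? length g
  ... | yes d<ℓ = d<ℓ
  ... | no  d≮ℓ = contradiction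
    (J0-countIn≤ (≤-trans (*-monoʳ-≤ m (s≤s (≮⇒≥ d≮ℓ))) md≤Nk) uniq (proj₂ (path⊆arc linked)))
    (<⇒≱ k<count)

corollary4p7 : (d k m n : ℕ) → .{{_ : NonZero m}} →
    1 ≤ d → d ≤ n / 2 → 3 ≤ k → k ≤ n / 2 + 2 →
    GpIs n k d m → IsKGenDPos n k d (J0 n m)
corollary4p7 zero    _       _ _       () _     _ _ _
corollary4p7 (suc d) zero    _ _       _  _     () _ _
corollary4p7 (suc d) (suc k) _ zero    _  ()    _ _ _
corollary4p7 (suc d) (suc k) m (suc n) _  d≤n/2 _ _ ((S , S-gp , ∣S∣≡m) , _) =
  J0-isKGenDPos (suc n) (subst (λ c → c * suc (suc d) ≤ suc n * k) ∣S∣≡m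
    (IsKGenDPos⇒∣S∣*[1+d]≤N*k (suc n) (m≤n/2⇒m+m≤n d≤n/2) S-gp))
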